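{- Let $r$ and $s$ be positive integers, both odd. Then there exist sets $S$ of positive integers with lower density $\frac{rs}{(r+s)^2}$ and upper density $\frac{s}{r+s}$ that can be permuted to avoid $(r,s)$ $3$-progressions.
   Context: For a set $S$ of positive integers, the lower density is $\liminf_{n\to\infty}\frac{|S\cap[1,n]|}{n}$ and the upper density is $\limsup_{n\to\infty}\frac{|S\cap[1,n]|}{n}$. An $(r,s)$ $3$-progression is a sequence $a, a+rd, a+rd+sd$ of integers with $d\neq0$. A permutation of $S$ is a sequence $p_1,p_2,\dots$ in which every element of $S$ appears exactly once. It contains an $(r,s)$ $3$-progression if there are indices $i_1<i_2<i_3$ such that $p_{i_1},p_{i_2},p_{i_3}$ is one. $S$ can be permuted to avoid $(r,s)$ $3$-progressions if some permutation of $S$ contains none. -}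

module Defs where

open import Data.Nat using (ℕ; zero; suc; _+_; _*_; _<_)
open import Data.Bool using (Bool; true; false; if_then_else_)
open import Data.Integer using (ℤ; +_; _-_) renaming (_*_ to _*ℤ_; _+_ to _+ℤ_)
open import Data.Rational using (ℚ; 0ℚ; _/_) renaming (_<_ to _<ℚ_; _+_ to _+ℚ_; _-_ to _-ℚ_)
open import Data.Product using (Σ; ∃; ∃-syntax; _×_)
open import Relation.Binary.PropositionalEquality using (_≡_; _≢_)
open import Relation.Nullary using (¬_)

Odd : ℕ → Set
Odd n = ∃[ k ] n ≡ suc (2 * k)

-- a set of positive integers, given by its (decidable) characteristic function;
-- membership of 0 is ignored by requiring S 0 ≡ false in the theorem
Subset : Set
Subset = ℕ → Bool

_∈S_ : ℕ → Subset → Set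
m ∈S S = S m ≡ true

count : Subset → ℕ → ℕ
count S zero = 0
count S (suc n) = (if S (suc n) then 1 else 0) + count S n

-- the rational a / d  (d = 0 gives the junk value 0)
frac : ℕ → ℕ → ℚ
frac a zero = 0ℚ
frac a (suc d) = (+ a) / suc d

ratio : Subset → ℕ → ℚ
ratio S n = frac (count S n) n

LowerDensity : Subset → ℚ → Set
LowerDensity S α =
  (∀ (ε : ℚ) → 0ℚ <ℚ ε → ∃[ N ] (∀ n → N < n → (α -ℚ ε) <ℚ ratio S n)) ×
  (∀ (ε : ℚ) → 0ℚ <ℚ ε → ∀ N → ∃[ n ] (N < n × ratio S n <ℚ (α +ℚ ε)))

UpperDensity : Subset → ℚ → Set
UpperDensity S α =
  (∀ (ε : ℚ) → 0ℚ <ℚ ε → ∃[ N ] (∀ n → N < n → ratio S n <ℚ (α +ℚ ε))) ×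
  (∀ (ε : ℚ) → 0ℚ <ℚ ε → ∀ N → ∃[ n ] (N < n × (α -ℚ ε) <ℚ ratio S n))

IsProgression : ℕ → ℕ → ℤ → ℤ → ℤ → Set
IsProgression r s x y z =
  ∃[ d ] (d ≢ + 0 × y ≡ x +ℤ (+ r) *ℤ d × z ≡ y +ℤ (+ s) *ℤ d)

IsPermutationOf : (ℕ → ℕ) → Subset → Set
IsPermutationOf p S =
  (∀ i → p i ∈S S) ×
  (∀ i j → p i ≡ p j → i ≡ j) ×
  (∀ m → m ∈S S → ∃[ i ] p i ≡ m)

ContainsProgression : ℕ → ℕ → (ℕ → ℕ) → Set
ContainsProgression r s p =
  ∃[ i ] ∃[ j ] ∃[ k ] (i < j × j < k × IsProgression r s (+ p i) (+ p j) (+ p k))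

PermutableAvoiding : ℕ → ℕ → Subset → Set
PermutableAvoiding r s S =
  ∃[ p ] (IsPermutationOf p S × ¬ ContainsProgression r s p)

module Submission where

open import Defs
open import Data.Nat using (ℕ; _+_; _*_; _<_)
open import Data.Bool using (false)
open import Data.Product using (∃-syntax; _×_)
open import Relation.Binary.PropositionalEquality using (_≡_)

open import Data.Nat
open import Data.Nat.Properties
open import Data.Nat.DivMod using (_/_; _%_; m≡m%n+[m/n]*n; m%n<n)
open import Data.Nat.Tactic.RingSolver using (solve-∀)
open import Data.Bool using (true; T; if_then_else_)
open import Data.Bool.Properties using (T-≡)
open import Data.Unit using (tt)
open import Data.Product using (_,_; proj₁; proj₂)
open import Data.Sum using (_⊎_; inj₁; inj₂)
open import Data.Empty using (⊥; ⊥-elim)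
open import Function.Bundles using (Equivalence)
open import Relation.Nullary using (¬_; Dec; yes; no)
open import Relation.Binary using (Tri; tri<; tri≈; tri>)
open import Relation.Binary.PropositionalEquality
import Data.Integer as ℤ
open ℤ using (+<+; +≤+) renaming (+_ to pos)
import Data.Integer.Properties as ℤ
open import Data.Integer.Tactic.RingSolver using () renaming (solve-∀ to ℤ-solve-∀)
open import Data.Rational as ℚ using (0ℚ; mkℚ; toℚᵘ)
import Data.Rational.Properties as ℚ
import Data.Rational.Unnormalised as ℚᵘ
import Data.Rational.Unnormalised.Properties as ℚᵘ

-- S is a union of blocks of consecutive integers separated by gaps.  The block
-- lengths are chosen so that at the end E of each block the count C = |S ∩ [1,E]|
-- satisfies s·E ≤ (r+s)·C < s·E + r ("balanced"), and the gap after it has length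
-- ⌊sE/r⌋; counting estimates at block ends, gap ends and in between give the two
-- densities (module Blocks, via the rational lemmas of CountingBounds).
--
-- The permutation lists the blocks in increasing order and each block in
-- "parity order": even offsets first, then odd ones, recursively (parityOrder).
-- An (r,s) progression x, y, z amounts to r·z + s·x = (r+s)·y with x ≠ y (Splits).
-- Within one block, oddness of r and s forces such a solution to be trivial
-- (parityOrder-avoids); across blocks, the gap lengths make it impossible
-- (splits-across-gap, splits-after-gap).

-- y divides the segment from x to z in the ratio r : s.  This is what an (r,s)
-- 3-progression x, y, z amounts to (together with x ≠ y).
Splits : ℕ → ℕ → ℕ → ℕ → ℕ → Set
Splits r s x y z = r * z + s * x ≡ (r + s) * y

progression⇒splits : ∀ r s x y z → IsProgression r s (pos x) (pos y) (pos z) → Splits r s x y z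
progression⇒splits r s x y z (d , _ , y≡ , z≡) = ℤ.+-injective (begin
  pos (r * z + s * x)                        ≡⟨ ℤ.pos-+ (r * z) (s * x) ⟩
  pos (r * z) ℤ.+ pos (s * x)                ≡⟨ cong₂ ℤ._+_ (ℤ.pos-* r z) (ℤ.pos-* s x) ⟩
  R ℤ.* pos z ℤ.+ S ℤ.* pos x                ≡⟨ cong (λ t → R ℤ.* t ℤ.+ S ℤ.* pos x) (trans z≡ (cong (ℤ._+ S ℤ.* d) y≡)) ⟩
  R ℤ.* (pos x ℤ.+ R ℤ.* d ℤ.+ S ℤ.* d) ℤ.+ S ℤ.* pos x ≡⟨ weighted-mean R S (pos x) d ⟩
  (R ℤ.+ S) ℤ.* (pos x ℤ.+ R ℤ.* d)          ≡⟨ cong ((R ℤ.+ S) ℤ.*_) (sym y≡) ⟩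
  (R ℤ.+ S) ℤ.* pos y                        ≡⟨ sym (ℤ.pos-* (r + s) y) ⟩
  pos ((r + s) * y)                          ∎)
  where
  open ≡-Reasoning
  R S : ℤ.ℤ
  R = pos r
  S = pos s
  weighted-mean : ∀ R S X D → R ℤ.* (X ℤ.+ R ℤ.* D ℤ.+ S ℤ.* D) ℤ.+ S ℤ.* X ≡ (R ℤ.+ S) ℤ.* (X ℤ.+ R ℤ.* D)
  weighted-mean = ℤ-solve-∀

progression⇒distinct : ∀ r s x y z → IsProgression (suc r) s (pos x) (pos y) (pos z) → x ≢ y
progression⇒distinct r s x y z (d , d≢0 , y≡ , _) refl =
  d≢0 (ℤ.*-cancelˡ-≡ (pos (suc r)) d (pos 0) (trans rd≡0 (sym (ℤ.*-zeroʳ (pos (suc r))))))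
  where
  difference : ∀ a t → t ≡ (a ℤ.+ t) ℤ.- a
  difference = ℤ-solve-∀
  rd≡0 : pos (suc r) ℤ.* d ≡ pos 0
  rd≡0 = trans (difference (pos x) (pos (suc r) ℤ.* d)) (trans (cong (ℤ._- pos x) (sym y≡)) (ℤ.+-inverseʳ (pos x)))

splits-shift : ∀ r s N a b c → Splits r s (N + a) (N + b) (N + c) → Splits r s a b c
splits-shift r s N a b c eq = +-cancelˡ-≡ ((r + s) * N) _ _ (trans (sym (lhs r s N a c)) (trans eq (rhs r s N b)))
  where
  lhs : ∀ r s N a c → r * (N + c) + s * (N + a) ≡ (r + s) * N + (r * c + s * a)
  lhs = solve-∀
  rhs : ∀ r s N b → (r + s) * (N + b) ≡ (r + s) * N + (r + s) * b
  rhs = solve-∀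

even-or-odd : ∀ a → (∃[ b ] a ≡ 2 * b) ⊎ (∃[ b ] a ≡ suc (2 * b))
even-or-odd zero = inj₁ (0 , refl)
even-or-odd (suc a) with even-or-odd a
... | inj₁ (b , a≡2b) = inj₂ (b , cong suc a≡2b)
... | inj₂ (b , a≡2b+1) = inj₁ (suc b , trans (cong suc a≡2b+1) (sym (*-suc 2 b)))

splits-even : ∀ r s a b c → Splits r s (2 * a) (2 * b) (2 * c) → Splits r s a b c
splits-even r s a b c eq = *-cancelˡ-≡ _ _ 2 (trans (sym (lhs r s a c)) (trans eq (rhs r s b)))
  where
  lhs : ∀ r s a c → r * (2 * c) + s * (2 * a) ≡ 2 * (r * c + s * a)
  lhs = solve-∀
  rhs : ∀ r s b → (r + s) * (2 * b) ≡ 2 * ((r + s) * b)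
  rhs = solve-∀

splits-odd : ∀ r s a b c → Splits r s (suc (2 * a)) (suc (2 * b)) (suc (2 * c)) → Splits r s a b c
splits-odd r s a b c eq =
  *-cancelˡ-≡ _ _ 2 (+-cancelˡ-≡ (r + s) _ _ (trans (sym (lhs r s a c)) (trans eq (rhs r s b))))
  where
  lhs : ∀ r s a c → r * suc (2 * c) + s * suc (2 * a) ≡ (r + s) + 2 * (r * c + s * a)
  lhs = solve-∀
  rhs : ∀ r s b → (r + s) * suc (2 * b) ≡ (r + s) + 2 * ((r + s) * b)
  rhs = solve-∀

-- For odd r and s the value r·z + s·x is odd when z is odd and x even, whereas
-- (r+s)·y is always even; so such x, y, z never satisfy the ratio condition.
splits-mixed : ∀ {r s} → Odd r → Odd s → ∀ a b c → ¬ Splits r s (2 * a) b (suc (2 * c))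
splits-mixed (kr , refl) (ks , refl) a b c eq =
  even≢odd (suc (kr + ks) * b) (c + kr * suc (2 * c) + suc (2 * ks) * a)
    (trans (sym (rhs kr ks b)) (trans (sym eq) (lhs kr (suc (2 * ks)) a c)))
  where
  lhs : ∀ kr s a c → suc (2 * kr) * suc (2 * c) + s * (2 * a) ≡ suc (2 * (c + kr * suc (2 * c) + s * a))
  lhs = solve-∀
  rhs : ∀ kr ks b → (suc (2 * kr) + suc (2 * ks)) * b ≡ 2 * (suc (kr + ks) * b)
  rhs = solve-∀

double<⇒<⌈/2⌉ : ∀ a L → 2 * a < L → a < ⌈ L /2⌉
double<⇒<⌈/2⌉ zero (suc L) _ = z<s
double<⇒<⌈/2⌉ (suc a) (suc (suc L)) h =
  s≤s (double<⇒<⌈/2⌉ a L (≤-pred (≤-pred (subst (_< suc (suc L)) (*-suc 2 a) h))))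
double<⇒<⌈/2⌉ (suc a) (suc zero) h = ⊥-elim (<⇒≱ h (subst (1 ≤_) (sym (*-suc 2 a)) (s≤s z≤n)))

<⌈/2⌉⇒double< : ∀ a L → a < ⌈ L /2⌉ → 2 * a < L
<⌈/2⌉⇒double< zero (suc L) _ = z<s
<⌈/2⌉⇒double< (suc a) (suc (suc L)) (s≤s h) =
  subst (_< suc (suc L)) (sym (*-suc 2 a)) (s≤s (s≤s (<⌈/2⌉⇒double< a L h)))
<⌈/2⌉⇒double< (suc a) (suc zero) (s≤s ())

double+1<⇒<⌊/2⌋ : ∀ a L → suc (2 * a) < L → a < ⌊ L /2⌋
double+1<⇒<⌊/2⌋ zero (suc (suc L)) _ = z<s
double+1<⇒<⌊/2⌋ (suc a) (suc (suc L)) h =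
  s≤s (double+1<⇒<⌊/2⌋ a L (≤-pred (≤-pred (subst (_< suc (suc L)) (cong suc (*-suc 2 a)) h))))
double+1<⇒<⌊/2⌋ a (suc zero) (s≤s ())

<⌊/2⌋⇒double+1< : ∀ a L → a < ⌊ L /2⌋ → suc (2 * a) < L
<⌊/2⌋⇒double+1< zero (suc (suc L)) _ = s≤s z<s
<⌊/2⌋⇒double+1< (suc a) (suc (suc L)) (s≤s h) =
  subst (_< suc (suc L)) (sym (cong suc (*-suc 2 a))) (s≤s (s≤s (<⌊/2⌋⇒double+1< a L h)))

upper-half-index : ∀ L i → i < L → ¬ (i < ⌈ L /2⌉) → i ∸ ⌈ L /2⌉ < ⌊ L /2⌋
upper-half-index L i i<L i≮h = +-cancelˡ-< ⌈ L /2⌉ (i ∸ ⌈ L /2⌉) ⌊ L /2⌋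
  (subst₂ _<_ (sym (m+[n∸m]≡n (≮⇒≥ i≮h))) (trans (sym (⌊n/2⌋+⌈n/2⌉≡n L)) (+-comm ⌊ L /2⌋ ⌈ L /2⌉)) i<L)

⌈/2⌉-fuel : ∀ L f → L ≤ suc (suc f) → ⌈ L /2⌉ ≤ suc f
⌈/2⌉-fuel zero f _ = z≤n
⌈/2⌉-fuel (suc zero) f _ = s≤s z≤n
⌈/2⌉-fuel (suc (suc L)) f h = ≤-pred (≤-trans (⌈n/2⌉<n L) h)

⌊/2⌋-fuel : ∀ L f → L ≤ suc (suc f) → ⌊ L /2⌋ ≤ suc f
⌊/2⌋-fuel L f h = ≤-trans (⌊n/2⌋≤⌈n/2⌉ L) (⌈/2⌉-fuel L f h)

single-index : ∀ {L i} → L ≤ 1 → i < L → i ≡ 0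
single-index (s≤s z≤n) (s≤s z≤n) = refl

-- parityOrder f L i is the i-th entry of an arrangement of {0,…,L-1}: first the even
-- numbers, arranged like their halves, then the odd numbers, arranged likewise.
-- f is recursion fuel; it suffices when L ≤ f + 1.
parityOrder : (f L i : ℕ) → ℕ
parityOrder zero L i = 0
parityOrder (suc f) L i with i <? ⌈ L /2⌉
... | yes _ = 2 * parityOrder f ⌈ L /2⌉ i
... | no _ = suc (2 * parityOrder f ⌊ L /2⌋ (i ∸ ⌈ L /2⌉))

parityOrder-lower : ∀ f L i → i < ⌈ L /2⌉ → parityOrder (suc f) L i ≡ 2 * parityOrder f ⌈ L /2⌉ i
parityOrder-lower f L i h with i <? ⌈ L /2⌉
... | yes _ = refl
... | no h' = ⊥-elim (h' h)

parityOrder-upper : ∀ f L i → ¬ (i < ⌈ L /2⌉) →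
                    parityOrder (suc f) L i ≡ suc (2 * parityOrder f ⌊ L /2⌋ (i ∸ ⌈ L /2⌉))
parityOrder-upper f L i h with i <? ⌈ L /2⌉
... | yes h' = ⊥-elim (h h')
... | no _ = refl

parityOrder-< : ∀ f L i → L ≤ suc f → i < L → parityOrder f L i < L
parityOrder-< zero L i _ i<L = ≤-trans z<s i<L
parityOrder-< (suc f) L i hf i<L with i <? ⌈ L /2⌉
... | yes lo = <⌈/2⌉⇒double< _ L (parityOrder-< f ⌈ L /2⌉ i (⌈/2⌉-fuel L f hf) lo)
... | no hi = <⌊/2⌋⇒double+1< _ L
  (parityOrder-< f ⌊ L /2⌋ (i ∸ ⌈ L /2⌉) (⌊/2⌋-fuel L f hf) (upper-half-index L i i<L hi))

parityOrder-injective : ∀ f L i j → L ≤ suc f → i < L → j < L →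
                        parityOrder f L i ≡ parityOrder f L j → i ≡ j
parityOrder-injective zero L i j hf i<L j<L _ = trans (single-index hf i<L) (sym (single-index hf j<L))
parityOrder-injective (suc f) L i j hf i<L j<L eq with i <? ⌈ L /2⌉ | j <? ⌈ L /2⌉
... | yes lo | yes lo' = parityOrder-injective f ⌈ L /2⌉ i j (⌈/2⌉-fuel L f hf) lo lo' (*-cancelˡ-≡ _ _ 2 eq)
... | yes _ | no _ = ⊥-elim (even≢odd (parityOrder f ⌈ L /2⌉ i) (parityOrder f ⌊ L /2⌋ (j ∸ ⌈ L /2⌉)) eq)
... | no _ | yes _ = ⊥-elim (even≢odd (parityOrder f ⌈ L /2⌉ j) (parityOrder f ⌊ L /2⌋ (i ∸ ⌈ L /2⌉)) (sym eq))
... | no hi | no hi' = begin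
  i                          ≡⟨ sym (m+[n∸m]≡n (≮⇒≥ hi)) ⟩
  ⌈ L /2⌉ + (i ∸ ⌈ L /2⌉)    ≡⟨ cong (⌈ L /2⌉ +_) shifted ⟩
  ⌈ L /2⌉ + (j ∸ ⌈ L /2⌉)    ≡⟨ m+[n∸m]≡n (≮⇒≥ hi') ⟩
  j                          ∎
  where
  open ≡-Reasoning
  shifted : i ∸ ⌈ L /2⌉ ≡ j ∸ ⌈ L /2⌉
  shifted = parityOrder-injective f ⌊ L /2⌋ _ _ (⌊/2⌋-fuel L f hf)
    (upper-half-index L i i<L hi) (upper-half-index L j j<L hi') (*-cancelˡ-≡ _ _ 2 (suc-injective eq))

parityOrder-surjective : ∀ f L a → L ≤ suc f → a < L → ∃[ i ] (i < L × parityOrder f L i ≡ a)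
parityOrder-surjective zero L a hf a<L = 0 , subst (_< L) (single-index hf a<L) a<L , sym (single-index hf a<L)
parityOrder-surjective (suc f) L a hf a<L with even-or-odd a
... | inj₁ (b , refl) =
  let (i , i<h , ord-i) = parityOrder-surjective f ⌈ L /2⌉ b (⌈/2⌉-fuel L f hf) (double<⇒<⌈/2⌉ b L a<L)
  in i , ≤-trans i<h (⌈n/2⌉≤n L) , trans (parityOrder-lower f L i i<h) (cong (2 *_) ord-i)
... | inj₂ (b , refl) =
  let (i , i<h , ord-i) = parityOrder-surjective f ⌊ L /2⌋ b (⌊/2⌋-fuel L f hf) (double+1<⇒<⌊/2⌋ b L a<L)
      h = ⌈ L /2⌉
      not-lower : ¬ (h + i < h)
      not-lower lt = <⇒≱ lt (m≤m+n h i)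
  in h + i
   , subst (h + i <_) (trans (+-comm h ⌊ L /2⌋) (⌊n/2⌋+⌈n/2⌉≡n L)) (+-monoʳ-< h i<h)
   , trans (parityOrder-upper f L (h + i) not-lower)
       (trans (cong (λ t → suc (2 * parityOrder f ⌊ L /2⌋ t)) (m+n∸m≡n h i))
              (cong (λ t → suc (2 * t)) ord-i))

-- Three entries in the same
-- half reduce to the half (splits-even/odd); an even x with an odd z is ruled out
-- by parity (splits-mixed); other placements contradict i < j < k.
parityOrder-avoids : ∀ {r s} → Odd r → Odd s → ∀ f L i j k → L ≤ suc f → i < j → j < k → k < L →
  Splits r s (parityOrder f L i) (parityOrder f L j) (parityOrder f L k) →
  parityOrder f L i ≡ parityOrder f L j
parityOrder-avoids odd-r odd-s zero L i j k hf i<j j<k k<L eq with single-index hf k<L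
... | refl = ⊥-elim (n≮0 j<k)
parityOrder-avoids {r} {s} odd-r odd-s (suc f) L i j k hf i<j j<k k<L eq
  with i <? ⌈ L /2⌉ | j <? ⌈ L /2⌉ | k <? ⌈ L /2⌉
... | yes _ | yes _ | yes k-lo = cong (2 *_)
  (parityOrder-avoids odd-r odd-s f ⌈ L /2⌉ i j k (⌈/2⌉-fuel L f hf) i<j j<k k-lo (splits-even r s _ _ _ eq))
... | yes _ | yes _ | no _ = ⊥-elim (splits-mixed odd-r odd-s
  (parityOrder f ⌈ L /2⌉ i) (2 * parityOrder f ⌈ L /2⌉ j) (parityOrder f ⌊ L /2⌋ (k ∸ ⌈ L /2⌉)) eq)
... | yes _ | no _ | no _ = ⊥-elim (splits-mixed odd-r odd-s
  (parityOrder f ⌈ L /2⌉ i) (suc (2 * parityOrder f ⌊ L /2⌋ (j ∸ ⌈ L /2⌉))) (parityOrder f ⌊ L /2⌋ (k ∸ ⌈ L /2⌉)) eq)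
... | no i-hi | no j-hi | no k-hi = cong (λ t → suc (2 * t))
  (parityOrder-avoids odd-r odd-s f ⌊ L /2⌋ (i ∸ h) (j ∸ h) (k ∸ h) (⌊/2⌋-fuel L f hf)
     (∸-monoˡ-< i<j (≮⇒≥ i-hi)) (∸-monoˡ-< j<k (≮⇒≥ j-hi)) (upper-half-index L k k<L k-hi)
     (splits-odd r s _ _ _ eq))
  where h = ⌈ L /2⌉
... | no i-hi | yes j-lo | _ = ⊥-elim (i-hi (<-trans i<j j-lo))
... | _ | no j-hi | yes k-lo = ⊥-elim (j-hi (<-trans j<k k-lo))

-- For a strictly increasing f, firstAbove n is the least k with n ≤ f k: it tells in
-- which of the intervals [0, f 0], (f 0, f 1], (f 1, f 2], … the number n lies.
module FirstAbove (f : ℕ → ℕ) (f-inc : ∀ k → f k < f (suc k)) where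

  f-mono : ∀ {j k} → j ≤ k → f j ≤ f k
  f-mono {k = zero} z≤n = ≤-refl
  f-mono {j} {suc k} j≤k with m≤n⇒m<n∨m≡n j≤k
  ... | inj₁ (s≤s j≤k') = ≤-trans (f-mono j≤k') (<⇒≤ (f-inc k))
  ... | inj₂ refl = ≤-refl

  IsFirstAbove : ℕ → ℕ → Set
  IsFirstAbove n k = n ≤ f k × (∀ j → j < k → f j < n)

  firstAbove : ℕ → ℕ
  firstAbove zero = 0
  firstAbove (suc n) with suc n ≤? f (firstAbove n)
  ... | yes _ = firstAbove n
  ... | no _ = suc (firstAbove n)

  right-end : ∀ n k → IsFirstAbove n k → ¬ (suc n ≤ f k) → f k ≡ n
  right-end n k (n≤fk , _) n+1≰fk = ≤-antisym (≤-pred (≰⇒> n+1≰fk)) n≤fk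

  firstAbove-spec : ∀ n → IsFirstAbove n (firstAbove n)
  firstAbove-spec zero = z≤n , λ j ()
  firstAbove-spec (suc n) with suc n ≤? f (firstAbove n) | firstAbove-spec n
  ... | yes fits | (_ , below) = fits , λ j j<k → m<n⇒m<1+n (below j j<k)
  ... | no leaves | spec@(_ , below) = next-above , earlier-below
    where
    k = firstAbove n
    fk≡n : f k ≡ n
    fk≡n = right-end n k spec leaves
    next-above : suc n ≤ f (suc k)
    next-above = subst (λ t → suc t ≤ f (suc k)) fk≡n (f-inc k)
    earlier-below : ∀ j → j < suc k → f j < suc n
    earlier-below j (s≤s j≤k) with m≤n⇒m<n∨m≡n j≤k
    ... | inj₁ j<k = m<n⇒m<1+n (below j j<k)
    ... | inj₂ refl = s≤s (≤-reflexive fk≡n)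

  firstAbove-unique : ∀ n k → IsFirstAbove n k → firstAbove n ≡ k
  firstAbove-unique n k (n≤fk , below) with <-cmp (firstAbove n) k | firstAbove-spec n
  ... | tri< lt _ _ | (n≤fk' , _) = ⊥-elim (<⇒≱ (below _ lt) n≤fk')
  ... | tri≈ _ eq _ | _ = eq
  ... | tri> _ _ gt | (_ , below') = ⊥-elim (<⇒≱ (below' k gt) n≤fk)

  firstAbove-mono : ∀ {n n'} → n ≤ n' → firstAbove n ≤ firstAbove n'
  firstAbove-mono {n} {n'} n≤n' = ≮⇒≥ λ lt →
    <⇒≱ (proj₂ (firstAbove-spec n) (firstAbove n') lt) (≤-trans n≤n' (proj₁ (firstAbove-spec n')))

  firstAbove-stay : ∀ n → suc n ≤ f (firstAbove n) → firstAbove (suc n) ≡ firstAbove n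
  firstAbove-stay n fits with suc n ≤? f (firstAbove n)
  ... | yes _ = refl
  ... | no leaves = ⊥-elim (leaves fits)

  firstAbove-leave : ∀ n → ¬ (suc n ≤ f (firstAbove n)) → firstAbove (suc n) ≡ suc (firstAbove n)
  firstAbove-leave n leaves with suc n ≤? f (firstAbove n)
  ... | yes fits = ⊥-elim (leaves fits)
  ... | no _ = refl

frac≃ : ∀ a X → toℚᵘ (frac a (suc X)) ℚᵘ.≃ ℚᵘ.mkℚᵘ (pos a) X
frac≃ a X = ℚ.toℚᵘ-fromℚᵘ (ℚᵘ.mkℚᵘ (pos a) X)

frac<frac+frac : ∀ x b y n z m → 0 < b → 0 < n → 0 < m →
                 x * (n * m) < (y * m + z * n) * b → frac x b ℚ.< frac y n ℚ.+ frac z m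
frac<frac+frac x (suc B) y (suc N) z (suc M) _ _ _ h =
  ℚ.toℚᵘ-cancel-< (ℚᵘ.<-respʳ-≃ (ℚᵘ.≃-sym sum≃) (ℚᵘ.<-respˡ-≃ (ℚᵘ.≃-sym (frac≃ x B)) unnormalised))
  where
  sum≃ : toℚᵘ (frac y (suc N) ℚ.+ frac z (suc M)) ℚᵘ.≃ ℚᵘ.mkℚᵘ (pos y) N ℚᵘ.+ ℚᵘ.mkℚᵘ (pos z) M
  sum≃ = ℚᵘ.≃-trans (ℚ.toℚᵘ-homo-+ (frac y (suc N)) (frac z (suc M))) (ℚᵘ.+-cong (frac≃ y N) (frac≃ z M))
  lhs : pos (x * (suc N * suc M)) ≡ pos x ℤ.* pos (suc N * suc M)
  lhs = ℤ.pos-* x (suc N * suc M)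
  rhs : pos ((y * suc M + z * suc N) * suc B) ≡ (pos y ℤ.* pos (suc M) ℤ.+ pos z ℤ.* pos (suc N)) ℤ.* pos (suc B)
  rhs = trans (ℤ.pos-* (y * suc M + z * suc N) (suc B))
          (cong (ℤ._* pos (suc B)) (trans (ℤ.pos-+ (y * suc M) (z * suc N))
            (cong₂ ℤ._+_ (ℤ.pos-* y (suc M)) (ℤ.pos-* z (suc N)))))
  unnormalised : ℚᵘ.mkℚᵘ (pos x) B ℚᵘ.< ℚᵘ.mkℚᵘ (pos y) N ℚᵘ.+ ℚᵘ.mkℚᵘ (pos z) M
  unnormalised = ℚᵘ.*<* (subst₂ ℤ._<_ lhs rhs (+<+ h))

unit-fraction-below : ∀ ε → 0ℚ ℚ.< ε → ∃[ W ] frac 1 (suc W) ℚ.≤ ε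
unit-fraction-below (mkℚ (pos zero) d _) (ℚ.*<* (+<+ ()))
unit-fraction-below (mkℚ ℤ.+[1+ p ] d _) _ =
  d , ℚ.toℚᵘ-cancel-≤ (ℚᵘ.≤-respˡ-≃ (ℚᵘ.≃-sym (frac≃ 1 d))
        (ℚᵘ.*≤* (+≤+ (*-monoˡ-≤ (suc d) {1} {suc p} (s≤s z≤n)))))
unit-fraction-below (mkℚ ℤ.-[1+ p ] d _) (ℚ.*<* ())

frac-below : ∀ a d c n K Q → 0 < d → d * c ≤ a * n + K → K * suc Q < n →
             frac c n ℚ.< frac a d ℚ.+ frac 1 (suc Q)
frac-below a (suc d) c n K Q d>0 dc≤ KQ<n =
  frac<frac+frac c n a (suc d) 1 (suc Q) (≤-<-trans z≤n KQ<n) d>0 z<s (begin-strict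
    c * (suc d * suc Q)             ≡⟨ sym (*-assoc c (suc d) (suc Q)) ⟩
    c * suc d * suc Q               ≡⟨ cong (_* suc Q) (*-comm c (suc d)) ⟩
    suc d * c * suc Q               ≤⟨ *-monoˡ-≤ (suc Q) dc≤ ⟩
    (a * n + K) * suc Q             ≡⟨ *-distribʳ-+ (suc Q) (a * n) K ⟩
    a * n * suc Q + K * suc Q       <⟨ +-monoʳ-< (a * n * suc Q) KQ<n ⟩
    a * n * suc Q + n               ≤⟨ +-monoʳ-≤ (a * n * suc Q) (m≤n*m n (suc d)) ⟩
    a * n * suc Q + suc d * n       ≡⟨ regroup a n (suc Q) (suc d) ⟩
    (a * suc Q + 1 * suc d) * n     ∎)
  where
  open ≤-Reasoning
  regroup : ∀ a n q d → a * n * q + d * n ≡ (a * q + 1 * d) * n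
  regroup = solve-∀

frac-above : ∀ a d c n K Q → 0 < d → a * n ≤ d * c + K → K * suc Q < n →
             frac a d ℚ.< frac c n ℚ.+ frac 1 (suc Q)
frac-above a (suc d) c n K Q d>0 an≤ KQ<n =
  frac<frac+frac a (suc d) c n 1 (suc Q) d>0 (≤-<-trans z≤n KQ<n) z<s (begin-strict
    a * (n * suc Q)                 ≡⟨ sym (*-assoc a n (suc Q)) ⟩
    a * n * suc Q                   ≤⟨ *-monoˡ-≤ (suc Q) an≤ ⟩
    (suc d * c + K) * suc Q         ≡⟨ *-distribʳ-+ (suc Q) (suc d * c) K ⟩
    suc d * c * suc Q + K * suc Q   <⟨ +-monoʳ-< (suc d * c * suc Q) KQ<n ⟩
    suc d * c * suc Q + n           ≤⟨ +-monoʳ-≤ (suc d * c * suc Q) (m≤n*m n (suc d)) ⟩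
    suc d * c * suc Q + suc d * n   ≡⟨ regroup (suc d) c (suc Q) n ⟩
    (c * suc Q + 1 * n) * suc d     ∎)
  where
  open ≤-Reasoning
  regroup : ∀ d c q n → d * c * q + d * n ≡ (c * q + 1 * n) * d
  regroup = solve-∀

widen-below : ∀ {x} y u {ε} → x ℚ.< y ℚ.+ u → u ℚ.≤ ε → x ℚ.< y ℚ.+ ε
widen-below y u x<y+u u≤ε = ℚ.<-≤-trans x<y+u (ℚ.+-monoʳ-≤ y u≤ε)

widen-above : ∀ {x} y u ε → x ℚ.< y ℚ.+ u → u ℚ.≤ ε → x ℚ.- ε ℚ.< y
widen-above {x} y u ε x<y+u u≤ε =
  subst (x ℚ.- ε ℚ.<_) y+ε-ε≡y (ℚ.+-monoˡ-< (ℚ.- ε) (widen-below y u x<y+u u≤ε))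
  where
  y+ε-ε≡y : y ℚ.+ ε ℚ.- ε ≡ y
  y+ε-ε≡y = trans (ℚ.+-assoc y ε (ℚ.- ε)) (trans (cong (y ℚ.+_) (ℚ.+-inverseʳ ε)) (ℚ.+-identityʳ y))

module CountingBounds (S : Subset) (a d : ℕ) (d>0 : 0 < d) where

  eventually-below : ∀ K → (∀ n → d * count S n ≤ a * n + K) →
    ∀ ε → 0ℚ ℚ.< ε → ∃[ N ] (∀ n → N < n → ratio S n ℚ.< frac a d ℚ.+ ε)
  eventually-below K bound ε ε>0 =
    let (W , unit≤ε) = unit-fraction-below ε ε>0
    in K * suc W , λ n n>N → widen-below (frac a d) (frac 1 (suc W)) (frac-below a d (count S n) n K W d>0 (bound n) n>N) unit≤ε

  eventually-above : ∀ K → (∀ n → a * n ≤ d * count S n + K) →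
    ∀ ε → 0ℚ ℚ.< ε → ∃[ N ] (∀ n → N < n → frac a d ℚ.- ε ℚ.< ratio S n)
  eventually-above K bound ε ε>0 =
    let (W , unit≤ε) = unit-fraction-below ε ε>0
    in K * suc W , λ n n>N → widen-above (frac (count S n) n) (frac 1 (suc W)) ε (frac-above a d (count S n) n K W d>0 (bound n) n>N) unit≤ε

  -- g k ≥ k exceeds both N and K·Q once k = N + K·Q + 1.
  private
    beyond : (g : ℕ → ℕ) → (∀ k → k ≤ g k) → ∀ N M → N < g (suc (N + M)) × M < g (suc (N + M))
    beyond g g≥ N M = ≤-trans (s≤s (m≤m+n N M)) (g≥ _) , ≤-trans (s≤s (m≤n+m M N)) (g≥ _)

  frequently-below : ∀ K → (g : ℕ → ℕ) → (∀ k → k ≤ g k) → (∀ k → d * count S (g k) ≤ a * g k + K) →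
    ∀ ε → 0ℚ ℚ.< ε → ∀ N → ∃[ n ] (N < n × ratio S n ℚ.< frac a d ℚ.+ ε)
  frequently-below K g g≥ bound ε ε>0 N =
    let (W , unit≤ε) = unit-fraction-below ε ε>0
        k = suc (N + K * suc W)
        (N<gk , KW<gk) = beyond g g≥ N (K * suc W)
    in g k , N<gk , widen-below (frac a d) (frac 1 (suc W)) (frac-below a d (count S (g k)) (g k) K W d>0 (bound k) KW<gk) unit≤ε

  frequently-above : ∀ K → (g : ℕ → ℕ) → (∀ k → k ≤ g k) → (∀ k → a * g k ≤ d * count S (g k) + K) →
    ∀ ε → 0ℚ ℚ.< ε → ∀ N → ∃[ n ] (N < n × frac a d ℚ.- ε ℚ.< ratio S n)
  frequently-above K g g≥ bound ε ε>0 N =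
    let (W , unit≤ε) = unit-fraction-below ε ε>0
        k = suc (N + K * suc W)
        (N<gk , KW<gk) = beyond g g≥ N (K * suc W)
    in g k , N<gk , widen-above (frac (count S (g k)) (g k)) (frac 1 (suc W)) ε (frac-above a d (count S (g k)) (g k) K W d>0 (bound k) KW<gk) unit≤ε

⟦_≤_⟧ : ℕ → ℕ → ℕ
⟦ a ≤ b ⟧ = if a ≤ᵇ b then 1 else 0

indicator-step : ∀ a m → ⟦ a ≤ suc m ⟧ + (suc m ∸ a) ≡ suc (suc m) ∸ a
indicator-step a m with a ≤ᵇ suc m in test
... | true = sym (+-∸-assoc 1 (≤ᵇ⇒≤ a (suc m) (subst T (sym test) tt)))
... | false = trans (m≤n⇒m∸n≡0 (<⇒≤ m+1<a)) (sym (m≤n⇒m∸n≡0 m+1<a))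
  where
  m+1<a : suc m < a
  m+1<a = ≰⇒> (λ a≤ → subst T test (≤⇒≤ᵇ a≤))

cancel-< : ∀ a b c d → a + b < c + d → d ≤ b → a < c
cancel-< a b c d a+b<c+d d≤b = +-cancelʳ-< b a c (<-≤-trans a+b<c+d (+-monoʳ-≤ c d≤b))

-- The block lengths keep
-- |S ∩ [1, last k]| / last k just above s/(r+s); the gap after a block ending at E
-- has length ⌊sE/r⌋: there the ratio drops to about rs/(r+s)², and the gap is long
-- enough to exclude progressions spread over several blocks.
module Blocks (r₀ s₀ : ℕ) where

  r s : ℕ
  r = suc r₀
  s = suc s₀

  gap : ℕ → ℕ
  gap E = s * E / r

  -- length minus one of the block after that gap, when C elements precede it
  extra : ℕ → ℕ → ℕ
  extra E C = (s * gap E ∸ suc ((r + s) * C ∸ s * E)) / r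

  record Balanced (E C : ℕ) : Set where
    field
      lower : s * E ≤ (r + s) * C
      upper : (r + s) * C < s * E + r
      large : r * r ≤ E

  module Extend (E C : ℕ) (bal : Balanced E C) where
    open Balanced bal

    -- gap length, block length minus one, and the excess (r+s)C - sE < r of the count
    q U e : ℕ
    q = gap E
    U = extra E C
    e = (r + s) * C ∸ s * E

    ρ : ℕ
    ρ = (s * E) % r

    sE≡ρ+qr : s * E ≡ ρ + q * r
    sE≡ρ+qr = m≡m%n+[m/n]*n (s * E) r

    gap-lower : q * r ≤ s * E
    gap-lower = subst (q * r ≤_) (sym sE≡ρ+qr) (m≤n+m (q * r) ρ)

    gap-upper : s * E < r * suc q
    gap-upper = begin-strict
      s * E        ≡⟨ sE≡ρ+qr ⟩
      ρ + q * r    <⟨ +-monoˡ-< (q * r) (m%n<n (s * E) r) ⟩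
      r + q * r    ≡⟨ cong (r +_) (*-comm q r) ⟩
      r + r * q    ≡⟨ sym (*-suc r q) ⟩
      r * suc q    ∎
      where open ≤-Reasoning

    -- Since E ≥ r², the gap has length at least r.
    r≤gap : r ≤ q
    r≤gap = ≤-pred (*-cancelˡ-< r r (suc q) (begin-strict
      r * r        ≤⟨ large ⟩
      E            ≤⟨ m≤n*m E s ⟩
      s * E        <⟨ gap-upper ⟩
      r * suc q    ∎))
      where open ≤-Reasoning

    excess : s * E + e ≡ (r + s) * C
    excess = m+[n∸m]≡n lower

    e<r : e < r
    e<r = +-cancelˡ-< (s * E) e r (subst (_< s * E + r) (sym excess) upper)

    -- the new block has length ⌊X/r⌋ + 1 for X = sq - (e+1); the subtraction is exact as e < r ≤ q
    X : ℕ
    X = s * q ∸ suc e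

    X+e+1≡sq : X + suc e ≡ s * q
    X+e+1≡sq = m∸n+n≡m (≤-trans e<r (≤-trans r≤gap (m≤n*m q s)))

    ρ' : ℕ
    ρ' = X % r

    X≡ρ'+Ur : X ≡ ρ' + U * r
    X≡ρ'+Ur = m≡m%n+[m/n]*n X r

    next-count : (r + s) * (C + suc U) + suc ρ' ≡ s * (E + suc q + U) + r
    next-count = begin
      (r + s) * (C + suc U) + suc ρ'                    ≡⟨ expand (r + s) C U ρ' ⟩
      (r + s) * C + (r + s + (r + s) * U + suc ρ')      ≡⟨ cong (_+ (r + s + (r + s) * U + suc ρ')) (sym excess) ⟩
      s * E + e + (r + s + (r + s) * U + suc ρ')        ≡⟨ regroup r s (s * E) e U ρ' ⟩
      s * E + s + (ρ' + U * r + suc e) + s * U + r      ≡⟨ cong (λ t → s * E + s + (t + suc e) + s * U + r) (sym X≡ρ'+Ur) ⟩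
      s * E + s + (X + suc e) + s * U + r               ≡⟨ cong (λ t → s * E + s + t + s * U + r) X+e+1≡sq ⟩
      s * E + s + s * q + s * U + r                     ≡⟨ collect s E q U r ⟩
      s * (E + suc q + U) + r                           ∎
      where
      open ≡-Reasoning
      expand : ∀ a C U ρ → a * (C + suc U) + suc ρ ≡ a * C + (a + a * U + suc ρ)
      expand = solve-∀
      regroup : ∀ r s sE e U ρ → sE + e + (r + s + (r + s) * U + suc ρ) ≡ sE + s + (ρ + U * r + suc e) + s * U + r
      regroup = solve-∀
      collect : ∀ s E q U r → s * E + s + s * q + s * U + r ≡ s * (E + suc q + U) + r
      collect = solve-∀

    balanced-next : Balanced (E + suc q + U) (C + suc U)
    balanced-next = record
      { lower = +-cancelʳ-≤ r _ _ (subst (_≤ (r + s) * (C + suc U) + r) next-count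
                  (+-monoʳ-≤ ((r + s) * (C + suc U)) (m%n<n X r)))
      ; upper = subst ((r + s) * (C + suc U) <_) next-count (m<m+n _ z<s)
      ; large = ≤-trans large (≤-trans (m≤m+n E (suc q)) (m≤m+n (E + suc q) U))
      }

    gap-separates : (r + s) * E < r * (E + suc q)
    gap-separates = begin-strict
      (r + s) * E          ≡⟨ *-distribʳ-+ E r s ⟩
      r * E + s * E        <⟨ +-monoʳ-< (r * E) gap-upper ⟩
      r * E + r * suc q    ≡⟨ sym (*-distribˡ-+ r E (suc q)) ⟩
      r * (E + suc q)      ∎
      where open ≤-Reasoning

    block-short : r * U < s * suc q
    block-short = begin-strict
      r * U            ≡⟨ *-comm r U ⟩
      U * r            ≤⟨ m≤n+m (U * r) ρ' ⟩
      ρ' + U * r       ≡⟨ sym X≡ρ'+Ur ⟩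
      X                <⟨ m<m+n X z<s ⟩
      X + suc e        ≡⟨ X+e+1≡sq ⟩
      s * q            ≤⟨ *-monoʳ-≤ s (n≤1+n q) ⟩
      s * suc q        ∎
      where open ≤-Reasoning

  -- (end of block k, |S ∩ [1, end of block k]|)
  -- The first block is [r²+1, r(r+s)], with rs elements; each later one is Extend's.
  state : ℕ → ℕ × ℕ
  state zero = r * (r + s) , r * s
  state (suc k) = let E = proj₁ (state k); C = proj₂ (state k)
                  in E + suc (gap E) + extra E C , C + suc (extra E C)

  last done : ℕ → ℕ
  last k = proj₁ (state k)
  done k = proj₂ (state k)

  -- block k is [first k, last k], of length len k, preceded by before k elements of S
  first len before : ℕ → ℕ
  first zero = suc (r * r)
  first (suc k) = last k + suc (gap (last k))
  len zero = r * s
  len (suc k) = suc (extra (last k) (done k))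
  before zero = 0
  before (suc k) = done k

  balanced : ∀ k → Balanced (last k) (done k)
  balanced zero = record
    { lower = ≤-reflexive (swap r s)
    ; upper = subst (_< s * (r * (r + s)) + r) (swap r s) (m<m+n _ z<s)
    ; large = *-monoʳ-≤ r (m≤m+n r s)
    }
    where
    swap : ∀ r s → s * (r * (r + s)) ≡ (r + s) * (r * s)
    swap = solve-∀
  balanced (suc k) = Extend.balanced-next (last k) (done k) (balanced k)

  module At (k : ℕ) = Extend (last k) (done k) (balanced k)

  last≡first+len : ∀ k → suc (last k) ≡ first k + len k
  last≡first+len zero = cong suc (*-distribˡ-+ r r s)
  last≡first+len (suc k) = sym (+-suc (first (suc k)) (extra (last k) (done k)))

  done≡before+len : ∀ k → done k ≡ before k + len k
  done≡before+len zero = refl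
  done≡before+len (suc k) = refl

  first≤last : ∀ k → first k ≤ last k
  first≤last k = ≤-pred (subst (first k <_) (sym (last≡first+len k)) (m<m+n (first k) (len-pos k)))
    where
    len-pos : ∀ k → 0 < len k
    len-pos zero = z<s
    len-pos (suc k) = z<s

  last<first : ∀ k → last k < first (suc k)
  last<first k = m<m+n (last k) z<s

  last-inc : ∀ k → last k < last (suc k)
  last-inc k = <-≤-trans (last<first k) (first≤last (suc k))

  done-inc : ∀ k → done k < done (suc k)
  done-inc k = m<m+n (done k) z<s

  k≤last : ∀ k → k ≤ last k
  k≤last zero = z≤n
  k≤last (suc k) = ≤-<-trans (k≤last k) (last-inc k)

  open FirstAbove last last-inc public
    using () renaming (firstAbove to blockOf; firstAbove-spec to blockOf-spec; f-mono to last-mono)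
  open FirstAbove last last-inc using (firstAbove-unique; firstAbove-stay; firstAbove-leave; right-end)

  S : Subset
  S n = first (blockOf n) ≤ᵇ n

  last<first-later : ∀ {j k} → j < k → last j < first k
  last<first-later {j} {suc k} (s≤s j≤k) = ≤-<-trans (last-mono j≤k) (last<first k)

  blockOf-inside : ∀ {k m} → first k ≤ m → m ≤ last k → blockOf m ≡ k
  blockOf-inside {k} {m} first≤m m≤last =
    firstAbove-unique m k (m≤last , λ j j<k → <-≤-trans (last<first-later j<k) first≤m)

  count-to-end : ∀ k → before k + (suc (last k) ∸ first k) ≡ done k
  count-to-end k = begin
    before k + (suc (last k) ∸ first k)      ≡⟨ cong (λ t → before k + (t ∸ first k)) (last≡first+len k) ⟩
    before k + (first k + len k ∸ first k)   ≡⟨ cong (before k +_) (m+n∸m≡n (first k) (len k)) ⟩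
    before k + len k                         ≡⟨ sym (done≡before+len k) ⟩
    done k                                   ∎
    where open ≡-Reasoning

  count-candidate-step : ∀ n →
    before (blockOf n) + (suc n ∸ first (blockOf n)) ≡ before (blockOf (suc n)) + (suc n ∸ first (blockOf (suc n)))
  count-candidate-step n = by-cases (suc n ≤? last k)
    where
    open ≡-Reasoning
    k = blockOf n
    by-cases : Dec (suc n ≤ last k) →
      before k + (suc n ∸ first k) ≡ before (blockOf (suc n)) + (suc n ∸ first (blockOf (suc n)))
    by-cases (yes fits) = cong (λ t → before t + (suc n ∸ first t)) (sym (firstAbove-stay n fits))
    by-cases (no leaves) = begin
      before k + (suc n ∸ first k)                  ≡⟨ cong (λ t → before k + (suc t ∸ first k)) (sym last≡n) ⟩
      before k + (suc (last k) ∸ first k)           ≡⟨ count-to-end k ⟩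
      done k                                        ≡⟨ sym (+-identityʳ (done k)) ⟩
      done k + 0                                    ≡⟨ cong (done k +_) (sym (m≤n⇒m∸n≡0 n+1≤first)) ⟩
      before (suc k) + (suc n ∸ first (suc k))      ≡⟨ cong (λ t → before t + (suc n ∸ first t)) (sym (firstAbove-leave n leaves)) ⟩
      before (blockOf (suc n)) + (suc n ∸ first (blockOf (suc n))) ∎
      where
      last≡n : last k ≡ n
      last≡n = right-end n k (blockOf-spec n) leaves
      n+1≤first : suc n ≤ first (suc k)
      n+1≤first = subst (λ t → suc t ≤ first (suc k)) last≡n (last<first k)

  count-formula : ∀ n → count S n ≡ before (blockOf n) + (suc n ∸ first (blockOf n))
  count-formula zero = refl
  count-formula (suc n) = begin
    ⟦ first k' ≤ suc n ⟧ + count S n                         ≡⟨ cong (⟦ first k' ≤ suc n ⟧ +_) (trans (count-formula n) (count-candidate-step n)) ⟩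
    ⟦ first k' ≤ suc n ⟧ + (before k' + (suc n ∸ first k'))  ≡⟨ swap ⟦ first k' ≤ suc n ⟧ (before k') _ ⟩
    before k' + (⟦ first k' ≤ suc n ⟧ + (suc n ∸ first k'))  ≡⟨ cong (before k' +_) (indicator-step (first k') n) ⟩
    before k' + (suc (suc n) ∸ first k')                     ∎
    where
    open ≡-Reasoning
    k' = blockOf (suc n)
    swap : ∀ a b c → a + (b + c) ≡ b + (a + c)
    swap = solve-∀

  count-at-last : ∀ k → count S (last k) ≡ done k
  count-at-last k = begin
    count S (last k)                                                  ≡⟨ count-formula (last k) ⟩
    before (blockOf (last k)) + (suc (last k) ∸ first (blockOf (last k))) ≡⟨ cong (λ t → before t + (suc (last k) ∸ first t)) (blockOf-inside {k} (first≤last k) ≤-refl) ⟩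
    before k + (suc (last k) ∸ first k)                               ≡⟨ count-to-end k ⟩
    done k                                                            ∎
    where open ≡-Reasoning

  count-in-gap : ∀ n → n < first (blockOf n) → count S n ≡ before (blockOf n)
  count-in-gap n n<first = trans (count-formula n)
    (trans (cong (before (blockOf n) +_) (m≤n⇒m∸n≡0 n<first)) (+-identityʳ _))

  count-in-block : ∀ n → first (blockOf n) ≤ n → count S n + (last (blockOf n) ∸ n) ≡ done (blockOf n)
  count-in-block n first≤n = begin
    count S n + (last k ∸ n)                        ≡⟨ cong (_+ (last k ∸ n)) (count-formula n) ⟩
    before k + (suc n ∸ first k) + (last k ∸ n)     ≡⟨ +-assoc (before k) _ _ ⟩
    before k + (suc n ∸ first k + (last k ∸ n))     ≡⟨ cong (before k +_) (sym (+-∸-comm (last k ∸ n) (≤-trans first≤n (n≤1+n n)))) ⟩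
    before k + (suc n + (last k ∸ n) ∸ first k)     ≡⟨ cong (λ t → before k + (suc t ∸ first k)) (m+[n∸m]≡n n≤last) ⟩
    before k + (suc (last k) ∸ first k)             ≡⟨ count-to-end k ⟩
    done k                                          ∎
    where
    open ≡-Reasoning
    k = blockOf n
    n≤last : n ≤ last k
    n≤last = proj₁ (blockOf-spec n)

  before-upper : ∀ k n → (∀ j → j < k → last j < n) → (r + s) * before k < s * n + r
  before-upper zero n _ = subst (_< s * n + r) (sym (*-zeroʳ (r + s))) (≤-trans z<s (m≤n+m r (s * n)))
  before-upper (suc k) n earlier =
    <-≤-trans (Balanced.upper (balanced k)) (+-monoˡ-≤ r (*-monoʳ-≤ s (<⇒≤ (earlier k ≤-refl))))

  -- … and then for every n: inside a block, each of the remaining w elements of the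
  -- block adds r + s to the left side but only s to the bound at the block end.
  count-upper : ∀ n → (r + s) * count S n < s * n + r
  count-upper n with first (blockOf n) ≤? n
  ... | no outside = subst (λ c → (r + s) * c < s * n + r) (sym (count-in-gap n (≰⇒> outside)))
                       (before-upper (blockOf n) n (proj₂ (blockOf-spec n)))
  ... | yes inside = cancel-< ((r + s) * count S n) ((r + s) * w) (s * n + r) (s * w) whole-block
                       (*-monoˡ-≤ w (m≤n+m s r))
    where
    k = blockOf n
    w = last k ∸ n
    whole-block : (r + s) * count S n + (r + s) * w < s * n + r + s * w
    whole-block = begin-strict
      (r + s) * count S n + (r + s) * w   ≡⟨ sym (*-distribˡ-+ (r + s) (count S n) w) ⟩
      (r + s) * (count S n + w)           ≡⟨ cong ((r + s) *_) (count-in-block n inside) ⟩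
      (r + s) * done k                    <⟨ Balanced.upper (balanced k) ⟩
      s * last k + r                      ≡⟨ cong (λ t → s * t + r) (sym (m+[n∸m]≡n (proj₁ (blockOf-spec n)))) ⟩
      s * (n + w) + r                     ≡⟨ regroup s n w r ⟩
      s * n + r + s * w                   ∎
      where
      open ≤-Reasoning
      regroup : ∀ s n w r → s * (n + w) + r ≡ s * n + r + s * w
      regroup = solve-∀

  count-at-last-lower : ∀ k → s * last k ≤ (r + s) * count S (last k) + 0
  count-at-last-lower k = subst (λ c → s * last k ≤ (r + s) * c + 0) (sym (count-at-last k))
    (≤-trans (Balanced.lower (balanced k)) (m≤m+n _ 0))

  K : ℕ
  K = r * s * (r * r)

  -- Lower estimate r s·m ≤ (r+s)²·|S ∩ [1,m]| + K, first for the points of a gap: by the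
  -- choice of the gap length, r s·(E + q) ≤ (r+s)·s·E ≤ (r+s)²·C.
  before-lower : ∀ k m → m < first k → r * s * m ≤ (r + s) * (r + s) * before k + K
  before-lower zero m m<first = ≤-trans (*-monoʳ-≤ (r * s) (≤-pred m<first)) (m≤n+m K _)
  before-lower (suc k) m m<first = begin
    r * s * m                          ≤⟨ *-monoʳ-≤ (r * s) m≤E+q ⟩
    r * s * (E + q)                    ≡⟨ spread r s E q ⟩
    r * s * E + s * (q * r)            ≤⟨ +-monoʳ-≤ (r * s * E) (*-monoʳ-≤ s (At.gap-lower k)) ⟩
    r * s * E + s * (s * E)            ≡⟨ collect r s E ⟩
    (r + s) * (s * E)                  ≤⟨ *-monoʳ-≤ (r + s) (Balanced.lower (balanced k)) ⟩
    (r + s) * ((r + s) * done k)       ≡⟨ sym (*-assoc (r + s) (r + s) (done k)) ⟩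
    (r + s) * (r + s) * done k         ≤⟨ m≤m+n _ K ⟩
    (r + s) * (r + s) * done k + K     ∎
    where
    open ≤-Reasoning
    E = last k
    q = gap E
    m≤E+q : m ≤ E + q
    m≤E+q = ≤-pred (subst (suc m ≤_) (+-suc E q) m<first)
    spread : ∀ r s E q → r * s * (E + q) ≡ r * s * E + s * (q * r)
    spread = solve-∀
    collect : ∀ r s E → r * s * E + s * (s * E) ≡ (r + s) * (s * E)
    collect = solve-∀

  first-suc : ∀ k → ∃[ m ] first k ≡ suc m
  first-suc zero = r * r , refl
  first-suc (suc k) = last k + gap (last k) , +-suc (last k) (gap (last k))

  -- … and then for every n: inside a block each element adds (r+s)² ≥ r s to the right side.
  count-lower : ∀ n → r * s * n ≤ (r + s) * (r + s) * count S n + K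
  count-lower n with first (blockOf n) ≤? n
  ... | no outside = subst (λ c → r * s * n ≤ (r + s) * (r + s) * c + K) (sym (count-in-gap n (≰⇒> outside)))
                       (before-lower (blockOf n) n (≰⇒> outside))
  ... | yes inside = begin
    r * s * n                                         ≡⟨ cong (r * s *_) (sym m₀+t≡n) ⟩
    r * s * (m₀ + t)                                  ≡⟨ *-distribˡ-+ (r * s) m₀ t ⟩
    r * s * m₀ + r * s * t                            ≤⟨ +-mono-≤ (before-lower k m₀ m₀<first) (*-monoˡ-≤ t rs≤B) ⟩
    B * before k + K + B * t                          ≡⟨ regroup B (before k) K t ⟩
    B * (before k + t) + K                            ≡⟨ cong (λ c → B * c + K) (sym (count-formula n)) ⟩
    B * count S n + K                                 ∎
    where
    open ≤-Reasoning
    B = (r + s) * (r + s)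
    k = blockOf n
    t = suc n ∸ first k
    m₀ = proj₁ (first-suc k)
    m₀<first : m₀ < first k
    m₀<first = ≤-reflexive (sym (proj₂ (first-suc k)))
    m₀+t≡n : m₀ + t ≡ n
    m₀+t≡n = suc-injective (trans (cong (_+ t) (sym (proj₂ (first-suc k)))) (m+[n∸m]≡n (≤-trans inside (n≤1+n n))))
    rs≤B : r * s ≤ B
    rs≤B = *-mono-≤ (m≤m+n r s) (m≤n+m s r)
    regroup : ∀ B P K t → B * P + K + B * t ≡ B * (P + t) + K
    regroup = solve-∀

  gapEnd : ℕ → ℕ
  gapEnd k = last k + gap (last k)

  gapEnd<first : ∀ k → gapEnd k < first (suc k)
  gapEnd<first k = ≤-reflexive (sym (+-suc (last k) (gap (last k))))

  count-at-gapEnd : ∀ k → count S (gapEnd k) ≡ done k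
  count-at-gapEnd k = trans (count-in-gap (gapEnd k) (subst (λ j → gapEnd k < first j) (sym in-gap) (gapEnd<first k)))
                            (cong before in-gap)
    where
    in-gap : blockOf (gapEnd k) ≡ suc k
    in-gap = firstAbove-unique (gapEnd k) (suc k)
      ( ≤-trans (<⇒≤ (gapEnd<first k)) (first≤last (suc k))
      , λ j j<k+1 → ≤-<-trans (last-mono (≤-pred j<k+1)) (m<m+n (last k) (≤-trans z<s (At.r≤gap k))))

  count-at-gapEnd-upper : ∀ k → (r + s) * (r + s) * count S (gapEnd k) ≤ r * s * gapEnd k + (r * s + r * (r + s))
  count-at-gapEnd-upper k = <⇒≤ (begin-strict
    (r + s) * (r + s) * count S (gapEnd k)  ≡⟨ cong ((r + s) * (r + s) *_) (count-at-gapEnd k) ⟩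
    (r + s) * (r + s) * C                   ≡⟨ *-assoc (r + s) (r + s) C ⟩
    (r + s) * ((r + s) * C)                 <⟨ *-monoʳ-< (r + s) (Balanced.upper (balanced k)) ⟩
    (r + s) * (s * E + r)                   ≡⟨ expand r s E ⟩
    r * s * E + s * (s * E) + (r + s) * r   ≤⟨ +-monoˡ-≤ ((r + s) * r) (+-monoʳ-≤ (r * s * E) (*-monoʳ-≤ s (<⇒≤ (At.gap-upper k)))) ⟩
    r * s * E + s * (r * suc q) + (r + s) * r ≡⟨ collect r s E q ⟩
    r * s * (E + q) + (r * s + r * (r + s)) ∎)
    where
    open ≤-Reasoning
    E = last k
    C = done k
    q = gap E
    expand : ∀ r s E → (r + s) * (s * E + r) ≡ r * s * E + s * (s * E) + (r + s) * r
    expand = solve-∀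
    collect : ∀ r s E q → r * s * E + s * (r * suc q) + (r + s) * r ≡ r * s * (E + q) + (r * s + r * (r + s))
    collect = solve-∀

  lower-density : LowerDensity S (frac (r * s) ((r + s) * (r + s)))
  lower-density = eventually-above K count-lower
                , frequently-below (r * s + r * (r + s)) gapEnd (λ k → ≤-trans (k≤last k) (m≤m+n _ _)) count-at-gapEnd-upper
    where open CountingBounds S (r * s) ((r + s) * (r + s)) z<s

  upper-density : UpperDensity S (frac s (r + s))
  upper-density = eventually-below r (λ n → <⇒≤ (count-upper n))
                , frequently-above 0 last k≤last count-at-last-lower
    where open CountingBounds S s (r + s) z<s

  open FirstAbove done done-inc using ()
    renaming (firstAbove to blockAfter; firstAbove-spec to blockAfter-spec;
              firstAbove-unique to blockAfter-unique; firstAbove-mono to blockAfter-mono; f-mono to done-mono)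

  -- position i belongs to block blockAt i, the least k with i < done k
  blockAt : ℕ → ℕ
  blockAt i = blockAfter (suc i)

  offset : ℕ → ℕ
  offset i = i ∸ before (blockAt i)

  arrange : ℕ → ℕ → ℕ
  arrange L = parityOrder L L

  perm : ℕ → ℕ
  perm i = first (blockAt i) + arrange (len (blockAt i)) (offset i)

  done≤before : ∀ {j k} → j < k → done j ≤ before k
  done≤before {j} {suc k} (s≤s j≤k) = done-mono j≤k

  blockAt-bounds : ∀ i → before (blockAt i) ≤ i × i < done (blockAt i)
  blockAt-bounds i = before≤ (blockAt i) (proj₂ (blockAfter-spec (suc i))) , proj₁ (blockAfter-spec (suc i))
    where
    before≤ : ∀ k → (∀ j → j < k → done j < suc i) → before k ≤ i
    before≤ zero _ = z≤n
    before≤ (suc k) earlier = ≤-pred (earlier k ≤-refl)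

  blockAt-unique : ∀ i k → before k ≤ i → i < done k → blockAt i ≡ k
  blockAt-unique i k before≤i i<done =
    blockAfter-unique (suc i) k (i<done , λ j j<k → s≤s (≤-trans (done≤before j<k) before≤i))

  blockAt-mono : ∀ {i j} → i ≤ j → blockAt i ≤ blockAt j
  blockAt-mono i≤j = blockAfter-mono (s≤s i≤j)

  offset-< : ∀ i → offset i < len (blockAt i)
  offset-< i = +-cancelˡ-< (before k) (offset i) (len k)
    (subst₂ _<_ (sym (m+[n∸m]≡n (proj₁ (blockAt-bounds i)))) (done≡before+len k) (proj₂ (blockAt-bounds i)))
    where k = blockAt i

  offset-inverse : ∀ i → before (blockAt i) + offset i ≡ i
  offset-inverse i = m+[n∸m]≡n (proj₁ (blockAt-bounds i))

  arrange-< : ∀ L o → o < L → arrange L o < L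
  arrange-< L o o<L = parityOrder-< L L o (n≤1+n L) o<L

  block-element : ∀ k v → v < len k → first k + v ≤ last k
  block-element k v v<len = ≤-pred (subst (first k + v <_) (sym (last≡first+len k)) (+-monoʳ-< (first k) v<len))

  perm-lower : ∀ i → first (blockAt i) ≤ perm i
  perm-lower i = m≤m+n _ _

  perm-upper : ∀ i → perm i ≤ last (blockAt i)
  perm-upper i = block-element (blockAt i) _ (arrange-< _ _ (offset-< i))

  perm-member : ∀ i → perm i ∈S S
  perm-member i = Equivalence.to T-≡ (subst (λ k → T (first k ≤ᵇ perm i))
    (sym (blockOf-inside {blockAt i} (perm-lower i) (perm-upper i))) (≤⇒≤ᵇ (perm-lower i)))

  perm-injective : ∀ i j → perm i ≡ perm j → i ≡ j
  perm-injective i j eq with <-cmp (blockAt i) (blockAt j)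
  ... | tri< lt _ _ = ⊥-elim (<⇒≱ (≤-<-trans (perm-upper i) (<-≤-trans (last<first-later lt) (perm-lower j))) (≤-reflexive (sym eq)))
  ... | tri> _ _ gt = ⊥-elim (<⇒≱ (≤-<-trans (perm-upper j) (<-≤-trans (last<first-later gt) (perm-lower i))) (≤-reflexive eq))
  ... | tri≈ _ same _ = begin
    i                                   ≡⟨ sym (offset-inverse i) ⟩
    before (blockAt i) + offset i       ≡⟨ cong₂ _+_ (cong before same) same-offset ⟩
    before (blockAt j) + offset j       ≡⟨ offset-inverse j ⟩
    j                                   ∎
    where
    open ≡-Reasoning
    k = blockAt i
    offset-j : j ∸ before k < len k
    offset-j = subst (λ t → j ∸ before t < len t) (sym same) (offset-< j)
    same-arranged : arrange (len k) (offset i) ≡ arrange (len k) (j ∸ before k)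
    same-arranged = +-cancelˡ-≡ (first k) _ _ (trans eq (cong (λ t → first t + arrange (len t) (j ∸ before t)) (sym same)))
    same-offset : offset i ≡ offset j
    same-offset = trans (parityOrder-injective (len k) (len k) _ _ (n≤1+n _) (offset-< i) offset-j same-arranged)
                        (cong (λ t → j ∸ before t) same)

  perm-surjective : ∀ m → m ∈S S → ∃[ i ] perm i ≡ m
  perm-surjective m m∈S = i , (begin
    perm i                                   ≡⟨ cong (λ t → first t + arrange (len t) (i ∸ before t)) i-in-k ⟩
    first k + arrange (len k) (before k + o ∸ before k) ≡⟨ cong (λ t → first k + arrange (len k) t) (m+n∸m≡n (before k) o) ⟩
    first k + arrange (len k) o              ≡⟨ cong (first k +_) arranged ⟩
    first k + (m ∸ first k)                  ≡⟨ m+[n∸m]≡n first≤m ⟩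
    m                                        ∎)
    where
    open ≡-Reasoning
    k = blockOf m
    first≤m : first k ≤ m
    first≤m = ≤ᵇ⇒≤ (first k) m (Equivalence.from T-≡ m∈S)
    m-first<len : m ∸ first k < len k
    m-first<len = +-cancelˡ-< (first k) _ _
      (subst₂ _<_ (sym (m+[n∸m]≡n first≤m)) (last≡first+len k) (s≤s (proj₁ (blockOf-spec m))))
    preimage = parityOrder-surjective (len k) (len k) (m ∸ first k) (n≤1+n _) m-first<len
    o = proj₁ preimage
    arranged : arrange (len k) o ≡ m ∸ first k
    arranged = proj₂ (proj₂ preimage)
    i = before k + o
    i-in-k : blockAt i ≡ k
    i-in-k = blockAt-unique i k (m≤m+n _ o)
      (subst (i <_) (sym (done≡before+len k)) (+-monoʳ-< (before k) (proj₁ (proj₂ preimage))))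

  -- No solution has y in an earlier block than z: across the gap, r·z outweighs (r+s)·y.
  splits-across-gap : ∀ {j k} x y z → j < k → y ≤ last j → first k ≤ z → ¬ Splits r s x y z
  splits-across-gap {j} {suc k} x y z (s≤s j≤k) y≤last first≤z eq = <-irrefl refl (begin-strict
    (r + s) * y          ≤⟨ *-monoʳ-≤ (r + s) (≤-trans y≤last (last-mono j≤k)) ⟩
    (r + s) * last k     <⟨ At.gap-separates k ⟩
    r * first (suc k)    ≤⟨ *-monoʳ-≤ r first≤z ⟩
    r * z                ≤⟨ m≤m+n (r * z) (s * x) ⟩
    r * z + s * x        ≡⟨ eq ⟩
    (r + s) * y          ∎)
    where open ≤-Reasoning

  -- No solution has x in an earlier block than y and z in y's block: that block is
  -- short compared with the gap before it, so r·z + s·x falls short of (r+s)·y.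
  splits-after-gap : ∀ {j k} x y z → j < k → x ≤ last j → first k ≤ y → z ≤ last k → ¬ Splits r s x y z
  splits-after-gap {j} {suc k} x y z (s≤s j≤k) x≤last first≤y z≤last eq = <-irrefl refl (begin-strict
    r * z + s * x                 ≤⟨ +-mono-≤ (*-monoʳ-≤ r z≤last) (*-monoʳ-≤ s (≤-trans x≤last (last-mono j≤k))) ⟩
    r * (N + U) + s * E           ≡⟨ regroup r s N U E ⟩
    r * N + s * E + r * U         <⟨ +-monoʳ-< (r * N + s * E) (At.block-short k) ⟩
    r * N + s * E + s * suc q     ≡⟨ collect r s E q ⟩
    (r + s) * N                   ≤⟨ *-monoʳ-≤ (r + s) first≤y ⟩
    (r + s) * y                   ≡⟨ sym eq ⟩
    r * z + s * x                 ∎)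
    where
    open ≤-Reasoning
    E = last k
    q = gap E
    N = first (suc k)
    U = At.U k
    regroup : ∀ r s N U E → r * (N + U) + s * E ≡ r * N + s * E + r * U
    regroup = solve-∀
    collect : ∀ r s E q → r * (E + suc q) + s * E + s * suc q ≡ (r + s) * (E + suc q)
    collect = solve-∀

  in-block : ∀ i k → blockAt i ≡ k →
             before k ≤ i × i ∸ before k < len k × perm i ≡ first k + arrange (len k) (i ∸ before k)
  in-block i k refl = proj₁ (blockAt-bounds i) , offset-< i , refl

  splits-in-block : Odd r → Odd s → ∀ i j l k → blockAt i ≡ k → blockAt j ≡ k → blockAt l ≡ k →
                    i < j → j < l → Splits r s (perm i) (perm j) (perm l) → perm i ≡ perm j
  splits-in-block odd-r odd-s i j l k i∈k j∈k l∈k i<j j<l eq =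
    trans perm-i (trans (cong (first k +_) trivial) (sym perm-j))
    where
    L = len k
    P = before k
    in-i = in-block i k i∈k
    in-j = in-block j k j∈k
    in-l = in-block l k l∈k
    perm-i = proj₂ (proj₂ in-i)
    perm-j = proj₂ (proj₂ in-j)
    perm-l = proj₂ (proj₂ in-l)
    shifted : Splits r s (arrange L (i ∸ P)) (arrange L (j ∸ P)) (arrange L (l ∸ P))
    shifted = splits-shift r s (first k) _ _ _
      (trans (sym (cong₂ (λ z x → r * z + s * x) perm-l perm-i)) (trans eq (cong ((r + s) *_) perm-j)))
    trivial : arrange L (i ∸ P) ≡ arrange L (j ∸ P)
    trivial = parityOrder-avoids odd-r odd-s L L (i ∸ P) (j ∸ P) (l ∸ P) (n≤1+n L)
      (∸-monoˡ-< i<j (proj₁ in-i)) (∸-monoˡ-< j<l (proj₁ in-j)) (proj₁ (proj₂ in-l)) shifted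

  -- For odd r and s the permutation contains no (r,s) 3-progression: compare the
  -- blocks of the three positions, which are non-decreasing.
  perm-avoids : Odd r → Odd s → ¬ ContainsProgression r s perm
  perm-avoids odd-r odd-s (i , j , l , i<j , j<l , prog) =
    by-blocks (<-cmp (blockAt j) (blockAt l)) (<-cmp (blockAt i) (blockAt j))
    where
    eq = progression⇒splits r s (perm i) (perm j) (perm l) prog
    by-blocks : Tri (blockAt j < blockAt l) (blockAt j ≡ blockAt l) (blockAt j > blockAt l) →
                Tri (blockAt i < blockAt j) (blockAt i ≡ blockAt j) (blockAt i > blockAt j) → ⊥
    by-blocks (tri> _ _ gt) _ = <⇒≱ gt (blockAt-mono (<⇒≤ j<l))
    by-blocks (tri< lt _ _) _ = splits-across-gap _ _ _ lt (perm-upper j) (perm-lower l) eq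
    by-blocks (tri≈ _ _ _) (tri> _ _ gt) = <⇒≱ gt (blockAt-mono (<⇒≤ i<j))
    by-blocks (tri≈ _ same _) (tri< lt _ _) = splits-after-gap _ _ _ lt (perm-upper i) (perm-lower j)
      (subst (λ k → perm l ≤ last k) (sym same) (perm-upper l)) eq
    by-blocks (tri≈ _ same-jl _) (tri≈ _ same-ij _) =
      progression⇒distinct r₀ s (perm i) (perm j) (perm l) prog
        (splits-in-block odd-r odd-s i j l (blockAt j) same-ij refl (sym same-jl) i<j j<l eq)

mainTheorem11 : ∀ (r s : ℕ) → 0 < r → 0 < s → Odd r → Odd s →
    ∃[ S ] (S 0 ≡ false ×
            LowerDensity S (frac (r * s) ((r + s) * (r + s))) ×
            UpperDensity S (frac s (r + s)) ×
            PermutableAvoiding r s S)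
mainTheorem11 r s _ _ odd-r@(kr , refl) odd-s@(ks , refl) =
    S , refl , lower-density , upper-density
  , perm , (perm-member , perm-injective , perm-surjective) , perm-avoids odd-r odd-s
  where open Blocks (2 * kr) (2 * ks)
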